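{- Let $n\ge 2$ and $m\ge 2$. For $k\ge 2$ let $T_{n,k}$ be the number of pairs $(T,t)$ with $T$ a tree on $\{1,\dots,n\}$ and $t\colon\{1,\dots,n\}\to\{1,\dots,k\}$ a function whose image has at least two elements such that adjacent $v,v'$ satisfy $t(v)\ne t(v')$ and adjacent $v>v'$ satisfy $t(v)>t(v')$; and let $P_{n,m}$ be the number of such pairs with $k=m$ and $t$ surjective (properly tiered trees). Then \[ P_{n,m}=\sum_{k=0}^{m-2}(-1)^k\binom{m}{m-k}T_{n,m-k}. \] -}

module Defs where

open import Level using (0ℓ)
open import Data.Nat using (ℕ; zero; suc; _≤_; _∸_)
open import Data.Nat.Combinatorics using (_C_)
open import Data.Integer as ℤ using (ℤ; +_)
open import Data.Fin using (Fin; zero; suc; inject₁; fromℕ; _<_)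
open import Data.Vec using (Vec; lookup)
open import Data.Bool using (Bool; true)
open import Data.Product using (Σ; ∃; _×_; _,_; proj₁)
open import Relation.Nullary using (¬_)
open import Relation.Binary.PropositionalEquality using (_≡_; _≢_)
open import Relation.Binary.Bundles using (Setoid)
open import Function.Definitions using (Injective)
open import Function.Bundles using (Inverse)
import Relation.Binary.PropositionalEquality as P

-- A graph on the vertex set Fin n = {1,…,n} is given by its adjacency matrix.
AdjMat : ℕ → Set
AdjMat n = Vec (Vec Bool n) n

Adj : ∀ {n} → AdjMat n → Fin n → Fin n → Set
Adj A i j = lookup (lookup A i) j ≡ true

IsSimple : ∀ {n} → AdjMat n → Set
IsSimple A = (∀ i j → lookup (lookup A i) j ≡ lookup (lookup A j) i)
           × (∀ i → ¬ Adj A i i)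

data Walk {n} (A : AdjMat n) : Fin n → Fin n → Set where
  here : ∀ {i} → Walk A i i
  step : ∀ {i j k} → Adj A i j → Walk A j k → Walk A i k

Connected : ∀ {n} → AdjMat n → Set
Connected A = ∀ i j → Walk A i j

-- a cycle: r+3 ≥ 3 pairwise distinct vertices c₀,…,c_{r+2}, consecutive ones
-- adjacent, and the last adjacent to the first
HasCycle : ∀ {n} → AdjMat n → Set
HasCycle {n} A = Σ ℕ λ r → Σ (Fin (suc (suc (suc r))) → Fin n) λ c →
    Injective _≡_ _≡_ c
  × (∀ (i : Fin (suc (suc r))) → Adj A (c (inject₁ i)) (c (suc i)))
  × Adj A (c (fromℕ (suc (suc r)))) (c zero)

IsTree : ∀ {n} → AdjMat n → Set
IsTree A = IsSimple A × Connected A × ¬ HasCycle A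

-- the colouring t : {1,…,n} → {1,…,k} (stored as a vector, Fin k ordered as usual)
Colouring : ℕ → ℕ → Set
Colouring n k = Vec (Fin k) n

IsTiered : ∀ {n k} → AdjMat n → Colouring n k → Set
IsTiered {n} A t =
    (Σ (Fin n) λ i → Σ (Fin n) λ j → lookup t i ≢ lookup t j)
  × (∀ v v' → Adj A v v' → lookup t v ≢ lookup t v')
  × (∀ v v' → Adj A v v' → v' < v → lookup t v' < lookup t v)

Surjective : ∀ {n k} → Colouring n k → Set
Surjective {n} {k} t = ∀ (c : Fin k) → Σ (Fin n) λ i → lookup t i ≡ c

TCond : (n k : ℕ) → AdjMat n × Colouring n k → Set
TCond n k (A , t) = IsTree A × IsTiered A t

PCond : (n m : ℕ) → AdjMat n × Colouring n m → Set
PCond n m (A , t) = IsTree A × IsTiered A t × Surjective t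

dataSetoid : {D : Set} (Q : D → Set) → Setoid 0ℓ 0ℓ
dataSetoid {D} Q = record
  { Carrier = Σ D Q
  ; _≈_ = λ x y → proj₁ x ≡ proj₁ y
  ; isEquivalence = record { refl = P.refl ; sym = P.sym ; trans = P.trans } }

HasCard : {D : Set} (Q : D → Set) → ℕ → Set
HasCard Q N = Inverse (P.setoid (Fin N)) (dataSetoid Q)

sumTo : ℕ → (ℕ → ℤ) → ℤ
sumTo zero f = f zero
sumTo (suc K) f = sumTo K f ℤ.+ f (suc K)

rhs : ℕ → (ℕ → ℕ) → ℤ
rhs m T = sumTo (m ∸ 2) λ k →
  (ℤ.- ℤ.1ℤ) ℤ.^ k ℤ.* (+ ((m C (m ∸ k)) Data.Nat.* T (m ∸ k)))

-- Let a(k, j) count the pairs (T, t) with t tiered into k colours that use each of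
-- the colours 0, …, j−1. The pairs counted by a(k+1, j) that miss colour j
-- correspond exactly to those counted by a(k, j): deleting colour j (punchOut) and
-- re-inserting it (punchIn) are order embeddings on the colours actually used, so
-- they preserve tieredness. Hence a(k+1, j+1) = a(k+1, j) − a(k, j), and
-- P_{n,m} = a(m, m) is the m-th backward difference of k ↦ T_{n,k} at m, whose
-- binomial expansion is the stated alternating sum; its last two terms vanish
-- because T_{n,1} = T_{n,0} = 0.
module Submission where

open import Defs
open import Level using (0ℓ)
open import Data.Nat as ℕ using (ℕ; zero; suc; z≤n; s≤s; _≤_; _∸_)
import Data.Nat.Properties as ℕ
open import Data.Nat.Combinatorics using (_C_; nCk≡nC[n∸k]; nCk+nC[k+1]≡[n+1]C[k+1]; k>n⇒nCk≡0)
open import Data.Integer as ℤ using (ℤ; +_; _+_; _-_; -_; _*_; _^_; -1ℤ)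
import Data.Integer.Properties as ℤ
open import Data.Integer.Tactic.RingSolver using (solve-∀)
open import Data.Fin as Fin using (Fin; zero; suc; toℕ; punchIn; punchOut; fromℕ<)
import Data.Fin.Properties as Fin
open import Data.Vec using (lookup; tabulate; map)
import Data.Vec.Properties as Vec
open import Data.Product using (Σ; ∃; ∃₂; _×_; _,_; proj₁; proj₂)
open import Data.Empty using (⊥-elim)
open import Data.Sum using (inj₁; inj₂)
open import Function using (_∘_)
open import Function.Bundles using (Inverse; Injection)
open import Function.Definitions using (Congruent; StrictlyInverseˡ; StrictlyInverseʳ)
import Function.Consequences.Setoid as Consequences
open import Function.Properties.Inverse using (Inverse⇒Injection)
import Function.Construct.Composition as Composition
import Function.Construct.Symmetry as Symmetry
open import Relation.Nullary using (¬_; yes; no)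
open import Relation.Unary using (Decidable)
open import Relation.Binary.Bundles using (Setoid)
open import Relation.Binary.PropositionalEquality
  using (_≡_; _≢_; refl; sym; trans; cong; cong₂; subst; subst₂; module ≡-Reasoning)
open ≡-Reasoning

-- Finite cardinalities

module _ {S T : Setoid 0ℓ 0ℓ} where
  private
    module S = Setoid S
    module T = Setoid T

  mkInverse : (to : S.Carrier → T.Carrier) (from : T.Carrier → S.Carrier) →
    Congruent S._≈_ T._≈_ to → Congruent T._≈_ S._≈_ from →
    StrictlyInverseˡ T._≈_ to from → StrictlyInverseʳ S._≈_ to from →
    Inverse S T
  mkInverse to from to-cong from-cong invˡ invʳ = record
    { to = to ; from = from ; to-cong = to-cong ; from-cong = from-cong
    ; inverse = Consequences.strictlyInverseˡ⇒inverseˡ S T to-cong invˡ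
              , Consequences.strictlyInverseʳ⇒inverseʳ S T from-cong invʳ
    }

module _ {D : Set} {Q : D → Set} where

  HasCard-unique : ∀ {a b} → HasCard Q a → HasCard Q b → a ≡ b
  HasCard-unique H J = Fin.cantor-schröder-bernstein
      (Injection.injective (Inverse⇒Injection I))
      (Injection.injective (Inverse⇒Injection (Symmetry.inverse I)))
    where I = Composition.inverse H (Symmetry.inverse J)

  HasCard-empty : (∀ d → ¬ Q d) → HasCard Q 0
  HasCard-empty ¬Q = mkInverse (λ ()) (λ { (d , q) → ⊥-elim (¬Q d q) })
    (λ { {()} }) (λ { {d , q} → ⊥-elim (¬Q d q) }) (λ { (d , q) → ⊥-elim (¬Q d q) }) (λ ())

  HasCard-resp : {Q′ : D → Set} → (∀ d → Q d → Q′ d) → (∀ d → Q′ d → Q d) →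
    ∀ {N} → HasCard Q N → HasCard Q′ N
  HasCard-resp Q⇒Q′ Q′⇒Q H = Composition.inverse H
    (mkInverse (λ (d , q) → d , Q⇒Q′ d q) (λ (d , q) → d , Q′⇒Q d q)
               (λ e → e) (λ e → e) (λ _ → refl) (λ _ → refl))

  HasCard-restrict : ∀ {N M} (H : HasCard Q N) {R : D → Set} →
    HasCard (R ∘ proj₁ ∘ Inverse.to H) M → HasCard (λ d → Q d × R d) M
  HasCard-restrict H {R} J = Composition.inverse J
    (mkInverse (λ (i , r) → proj₁ (H.to i) , proj₂ (H.to i) , r)
               (λ (d , q , r) → H.from (d , q) , subst R (sym (H.strictlyInverseˡ (d , q))) r)
               (λ { refl → refl }) H.from-cong
               (λ (d , q , _) → H.strictlyInverseˡ (d , q)) (λ (i , _) → H.strictlyInverseʳ i))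
    where module H = Inverse H

module _ {N : ℕ} {R : Fin (suc N) → Set} {a : ℕ} (H : HasCard (R ∘ suc) a) where
  private module H = Inverse H

  HasCard-extend-yes : R zero → HasCard R (suc a)
  HasCard-extend-yes r = mkInverse to from (λ { refl → refl }) from-cong
      (λ { (zero , _) → refl ; (suc x , p) → cong suc (H.strictlyInverseˡ (x , p)) })
      (λ { zero → refl ; (suc i) → cong suc (H.strictlyInverseʳ i) })
    where
    to : Fin (suc a) → Σ (Fin (suc N)) R
    to zero    = zero , r
    to (suc i) = suc (proj₁ (H.to i)) , proj₂ (H.to i)
    from : Σ (Fin (suc N)) R → Fin (suc a)
    from (zero , _)  = zero
    from (suc x , p) = suc (H.from (x , p))
    from-cong : ∀ {x y} → proj₁ x ≡ proj₁ y → from x ≡ from y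
    from-cong {zero , _}  {zero , _}  _ = refl
    from-cong {suc x , p} {suc y , q} e = cong suc (H.from-cong (Fin.suc-injective e))

  HasCard-extend-no : ¬ R zero → HasCard R a
  HasCard-extend-no ¬r = mkInverse to from (λ { refl → refl }) from-cong
      (λ { (zero , r) → ⊥-elim (¬r r) ; (suc x , p) → cong suc (H.strictlyInverseˡ (x , p)) })
      H.strictlyInverseʳ
    where
    to : Fin a → Σ (Fin (suc N)) R
    to i = suc (proj₁ (H.to i)) , proj₂ (H.to i)
    from : Σ (Fin (suc N)) R → Fin a
    from (zero , r)  = ⊥-elim (¬r r)
    from (suc x , p) = H.from (x , p)
    from-cong : ∀ {x y} → proj₁ x ≡ proj₁ y → from x ≡ from y
    from-cong {zero , r}            _ = ⊥-elim (¬r r)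
    from-cong {suc _ , _} {zero , r} _ = ⊥-elim (¬r r)
    from-cong {suc x , p} {suc y , q} e = H.from-cong (Fin.suc-injective e)

Fin-partition : ∀ {N} {R : Fin N → Set} → Decidable R →
  ∃₂ λ a b → HasCard R a × HasCard (¬_ ∘ R) b × a ℕ.+ b ≡ N
Fin-partition {zero} R? = 0 , 0 , HasCard-empty (λ ()) , HasCard-empty (λ ()) , refl
Fin-partition {suc N} R? with Fin-partition (R? ∘ suc) | R? zero
... | a , b , Ha , Hb , a+b≡N | yes r =
  suc a , b , HasCard-extend-yes Ha r , HasCard-extend-no Hb (λ ¬r → ¬r r) , cong suc a+b≡N
... | a , b , Ha , Hb , a+b≡N | no ¬r =
  a , suc b , HasCard-extend-no Ha ¬r , HasCard-extend-yes Hb ¬r , trans (ℕ.+-suc a b) (cong suc a+b≡N)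

HasCard-partition : {D : Set} {Q R : D → Set} {N : ℕ} → HasCard Q N → Decidable R →
  ∃₂ λ a b → HasCard (λ d → Q d × R d) a × HasCard (λ d → Q d × ¬ R d) b × a ℕ.+ b ≡ N
HasCard-partition H R? with Fin-partition (R? ∘ proj₁ ∘ Inverse.to H)
... | a , b , Ha , Hb , a+b≡N = a , b , HasCard-restrict H Ha , HasCard-restrict H Hb , a+b≡N

-- Iterated backward differences

sumTo-cong : ∀ K {f g : ℕ → ℤ} → (∀ i → i ≤ K → f i ≡ g i) → sumTo K f ≡ sumTo K g
sumTo-cong zero    f≗g = f≗g 0 z≤n
sumTo-cong (suc K) f≗g =
  cong₂ _+_ (sumTo-cong K (λ i i≤K → f≗g i (ℕ.m≤n⇒m≤1+n i≤K))) (f≗g (suc K) ℕ.≤-refl)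

sumTo-suc : ∀ K (f : ℕ → ℤ) → sumTo (suc K) f ≡ f 0 + sumTo K (f ∘ suc)
sumTo-suc zero    f = refl
sumTo-suc (suc K) f = trans (cong (_+ f (suc (suc K))) (sumTo-suc K f)) (ℤ.+-assoc (f 0) _ _)

sumTo-neg-+ : ∀ K (f g : ℕ → ℤ) → sumTo K (λ i → - f i + g i) ≡ - sumTo K f + sumTo K g
sumTo-neg-+ zero    f g = refl
sumTo-neg-+ (suc K) f g = trans (cong (_+ (- f (suc K) + g (suc K))) (sumTo-neg-+ K f g))
    (regroup (sumTo K f) (sumTo K g) (f (suc K)) (g (suc K)))
  where
  regroup : ∀ a b c d → (- a + b) + (- c + d) ≡ - (a + c) + (b + d)
  regroup = solve-∀

∇ : ℕ → (ℕ → ℤ) → ℕ → ℤ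
∇ zero    f k = f k
∇ (suc j) f k = ∇ j f k - ∇ j f (ℕ.pred k)

binomialTerm : (ℕ → ℤ) → ℕ → ℕ → ℕ → ℤ
binomialTerm f j k i = -1ℤ ^ i * (+ (j C i) * f (k ∸ i))

binomialTerm-pascal : ∀ f j k i →
  binomialTerm f (suc j) k (suc i) ≡ - binomialTerm f j (ℕ.pred k) i + binomialTerm f j k (suc i)
binomialTerm-pascal f j k i = begin
  -1ℤ ^ suc i * (+ (suc j C suc i) * f (k ∸ suc i))
    ≡⟨ cong (λ c → -1ℤ ^ suc i * (c * f (k ∸ suc i)))
            (trans (cong +_ (sym (nCk+nC[k+1]≡[n+1]C[k+1] j i))) (ℤ.pos-+ (j C i) (j C suc i))) ⟩
  -1ℤ ^ suc i * ((+ (j C i) + + (j C suc i)) * f (k ∸ suc i))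
    ≡⟨ distribute (-1ℤ ^ i) (+ (j C i)) (+ (j C suc i)) (f (k ∸ suc i)) ⟩
  - (-1ℤ ^ i * (+ (j C i) * f (k ∸ suc i))) + binomialTerm f j k (suc i)
    ≡⟨ cong (λ l → - (-1ℤ ^ i * (+ (j C i) * f l)) + binomialTerm f j k (suc i))
            (sym (ℕ.∸-+-assoc k 1 i)) ⟩
  - binomialTerm f j (ℕ.pred k) i + binomialTerm f j k (suc i) ∎
  where
  distribute : ∀ s c d x → (-1ℤ * s) * ((c + d) * x) ≡ - (s * (c * x)) + (-1ℤ * s) * (d * x)
  distribute = solve-∀

binomialTerm-beyond : ∀ f j k → binomialTerm f j k (suc j) ≡ + 0
binomialTerm-beyond f j k = begin
  -1ℤ ^ suc j * (+ (j C suc j) * f (k ∸ suc j))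
    ≡⟨ cong (λ c → -1ℤ ^ suc j * (+ c * f (k ∸ suc j))) (k>n⇒nCk≡0 (ℕ.n<1+n j)) ⟩
  -1ℤ ^ suc j * (+ 0 * f (k ∸ suc j))
    ≡⟨ ℤ.*-zeroʳ (-1ℤ ^ suc j) ⟩
  + 0 ∎

binomialTerm-vanishing : ∀ f j k i → f (k ∸ i) ≡ + 0 → binomialTerm f j k i ≡ + 0
binomialTerm-vanishing f j k i fₖ₋ᵢ≡0 = begin
  -1ℤ ^ i * (+ (j C i) * f (k ∸ i)) ≡⟨ cong (λ x → -1ℤ ^ i * (+ (j C i) * x)) fₖ₋ᵢ≡0 ⟩
  -1ℤ ^ i * (+ (j C i) * + 0)       ≡⟨ cong (-1ℤ ^ i *_) (ℤ.*-zeroʳ (+ (j C i))) ⟩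
  -1ℤ ^ i * + 0                     ≡⟨ ℤ.*-zeroʳ (-1ℤ ^ i) ⟩
  + 0 ∎

∇-binomial : ∀ j f k → ∇ j f k ≡ sumTo j (binomialTerm f j k)
∇-binomial zero    f k = sym (trans (ℤ.*-identityˡ _) (ℤ.*-identityˡ _))
∇-binomial (suc j) f k = begin
  ∇ j f k - ∇ j f (ℕ.pred k)   ≡⟨ cong₂ _-_ (∇-binomial j f k) (∇-binomial j f (ℕ.pred k)) ⟩
  S - S′                        ≡⟨ cong (_- S′) (sym (ℤ.+-identityʳ S)) ⟩
  (S + + 0) - S′                ≡⟨ cong (λ x → (S + x) - S′) (sym (binomialTerm-beyond f j k)) ⟩
  sumTo (suc j) (a k) - S′      ≡⟨ cong (_- S′) (sumTo-suc j (a k)) ⟩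
  (a k 0 + B) - S′              ≡⟨ regroup (a k 0) B S′ ⟩
  a k 0 + (- S′ + B)
    ≡⟨ cong (λ x → a k 0 + x) (sym (sumTo-neg-+ j (a (ℕ.pred k)) (a k ∘ suc))) ⟩
  a k 0 + sumTo j (λ i → - a (ℕ.pred k) i + a k (suc i))
    ≡⟨ cong (λ x → a k 0 + x) (sumTo-cong j (λ i _ → sym (binomialTerm-pascal f j k i))) ⟩
  a k 0 + sumTo j (binomialTerm f (suc j) k ∘ suc)
    ≡⟨ sym (sumTo-suc j (binomialTerm f (suc j) k)) ⟩
  sumTo (suc j) (binomialTerm f (suc j) k) ∎
  where
  a = binomialTerm f j
  S = sumTo j (a k)
  S′ = sumTo j (a (ℕ.pred k))
  B = sumTo j (a k ∘ suc)
  regroup : ∀ x y z → (x + y) - z ≡ x + (- z + y)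
  regroup = solve-∀

-- Tiered colourings

toℕ-punchIn-< : ∀ {m} (i : Fin (suc m)) (j : Fin m) →
  toℕ j ℕ.< toℕ i → toℕ (punchIn i j) ≡ toℕ j
toℕ-punchIn-< (suc i) zero    _         = refl
toℕ-punchIn-< (suc i) (suc j) (s≤s j<i) = cong suc (toℕ-punchIn-< i j j<i)

toℕ-punchOut-< : ∀ {m} {i j : Fin (suc m)} (i≢j : i ≢ j) →
  toℕ j ℕ.< toℕ i → toℕ (punchOut i≢j) ≡ toℕ j
toℕ-punchOut-< {suc m} {suc i} {zero}  _   _         = refl
toℕ-punchOut-< {suc m} {suc i} {suc j} i≢j (s≤s j<i) = cong suc (toℕ-punchOut-< (i≢j ∘ cong suc) j<i)

isTiered-recolour : ∀ {n k k′} (A : AdjMat n) (t : Colouring n k) (t′ : Colouring n k′) →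
  (∀ i j → lookup t′ i ≡ lookup t′ j → lookup t i ≡ lookup t j) →
  (∀ i j → lookup t i Fin.≤ lookup t j → lookup t′ i Fin.≤ lookup t′ j) →
  IsTiered A t → IsTiered A t′
isTiered-recolour A t t′ reflects preserves ((i , j , tᵢ≢tⱼ) , adj-≢ , adj-<) =
    (i , j , tᵢ≢tⱼ ∘ reflects i j)
  , (λ v v′ v~v′ → adj-≢ v v′ v~v′ ∘ reflects v v′)
  , (λ v v′ v~v′ v′<v → preserves-< v′ v (adj-< v v′ v~v′ v′<v))
  where
  preserves-< : ∀ i j → lookup t i Fin.< lookup t j → lookup t′ i Fin.< lookup t′ j
  preserves-< i j tᵢ<tⱼ = Fin.≤∧≢⇒< (preserves i j (ℕ.<⇒≤ tᵢ<tⱼ)) (Fin.<⇒≢ tᵢ<tⱼ ∘ reflects i j)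

isTiered⇒2≤k : ∀ {n k} (A : AdjMat n) (t : Colouring n k) → IsTiered A t → 2 ≤ k
isTiered⇒2≤k A t ((i , j , tᵢ≢tⱼ) , _) with lookup t i | lookup t j
... | zero  | zero  = ⊥-elim (tᵢ≢tⱼ refl)
... | zero  | suc c = s≤s (ℕ.≤-trans (s≤s z≤n) (Fin.toℕ<n c))
... | suc c | _     = s≤s (ℕ.≤-trans (s≤s z≤n) (Fin.toℕ<n c))

module _ {n : ℕ} where

  Hit : ∀ {k} → Colouring n k → Fin k → Set
  Hit t c = ∃ λ i → lookup t i ≡ c

  HitsBelow : ∀ {k} → ℕ → Colouring n k → Set
  HitsBelow j t = ∀ c → toℕ c ℕ.< j → Hit t c

  TCondHitting : (k j : ℕ) → AdjMat n × Colouring n k → Set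
  TCondHitting k j (A , t) = TCond n k (A , t) × HitsBelow j t

  hitsBelow-suc : ∀ {k} {t : Colouring n k} (c : Fin k) →
    HitsBelow (toℕ c) t → Hit t c → HitsBelow (suc (toℕ c)) t
  hitsBelow-suc {t = t} c hits hit d d<1+c with ℕ.m≤n⇒m<n∨m≡n (ℕ.s≤s⁻¹ d<1+c)
  ... | inj₁ d<c = hits d d<c
  ... | inj₂ d≡c = subst (Hit t) (sym (Fin.toℕ-injective d≡c)) hit

  PCond⇒TCondHitting : ∀ m d → PCond n m d → TCondHitting m m d
  PCond⇒TCondHitting m d (tree , tiered , surjective) = (tree , tiered) , λ c _ → surjective c

  TCondHitting⇒PCond : ∀ m d → TCondHitting m m d → PCond n m d
  TCondHitting⇒PCond m d ((tree , tiered) , hits) = tree , tiered , λ c → hits c (Fin.toℕ<n c)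

  module _ {k : ℕ} (c : Fin (suc k)) where

    removeColour : (t : Colouring n (suc k)) → (∀ i → c ≢ lookup t i) → Colouring n k
    removeColour t avoids = tabulate (λ i → punchOut (avoids i))

    insertColour : Colouring n k → Colouring n (suc k)
    insertColour = map (punchIn c)

    private
      lookup-remove : ∀ t avoids i → lookup (removeColour t avoids) i ≡ punchOut (avoids i)
      lookup-remove t avoids i = Vec.lookup∘tabulate _ i

      lookup-insert : ∀ t i → lookup (insertColour t) i ≡ punchIn c (lookup t i)
      lookup-insert t i = Vec.lookup-map i (punchIn c) t

    removeColour-irrelevant : ∀ t avoids avoids′ → removeColour t avoids ≡ removeColour t avoids′
    removeColour-irrelevant t avoids avoids′ = Vec.tabulate-cong (λ _ → Fin.punchOut-cong c refl)

    insert-remove : ∀ t avoids → insertColour (removeColour t avoids) ≡ t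
    insert-remove t avoids = begin
      map (punchIn c) (tabulate (λ i → punchOut (avoids i))) ≡⟨ Vec.tabulate-∘ (punchIn c) _ ⟨
      tabulate (λ i → punchIn c (punchOut (avoids i)))     ≡⟨ Vec.tabulate-cong (Fin.punchIn-punchOut ∘ avoids) ⟩
      tabulate (lookup t)                                   ≡⟨ Vec.tabulate∘lookup t ⟩
      t                                                     ∎

    remove-insert : ∀ t avoids → removeColour (insertColour t) avoids ≡ t
    remove-insert t avoids = begin
      tabulate (λ i → punchOut (avoids i)) ≡⟨ Vec.tabulate-cong punchOut-insert ⟩
      tabulate (lookup t)                   ≡⟨ Vec.tabulate∘lookup t ⟩
      t                                     ∎
      where
      punchOut-insert : ∀ i → punchOut (avoids i) ≡ lookup t i
      punchOut-insert i = trans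
        (Fin.punchOut-cong c {i≢k = Fin.punchInᵢ≢i c (lookup t i) ∘ sym} (lookup-insert t i))
        (Fin.punchOut-punchIn c)

    isTiered-remove : ∀ A t avoids → IsTiered A t → IsTiered A (removeColour t avoids)
    isTiered-remove A t avoids = isTiered-recolour A t (removeColour t avoids)
      (λ i j e → Fin.punchOut-injective (avoids i) (avoids j)
                   (trans (sym (lookup-remove t avoids i)) (trans e (lookup-remove t avoids j))))
      (λ i j tᵢ≤tⱼ → subst₂ Fin._≤_ (sym (lookup-remove t avoids i)) (sym (lookup-remove t avoids j))
                        (Fin.punchOut-mono-≤ (avoids i) (avoids j) tᵢ≤tⱼ))

    isTiered-insert : ∀ A t → IsTiered A t → IsTiered A (insertColour t)
    isTiered-insert A t = isTiered-recolour A t (insertColour t)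
      (λ i j e → Fin.punchIn-injective c _ _
                   (trans (sym (lookup-insert t i)) (trans e (lookup-insert t j))))
      (λ i j tᵢ≤tⱼ → subst₂ Fin._≤_ (sym (lookup-insert t i)) (sym (lookup-insert t j))
                        (Fin.punchIn-mono-≤ c _ _ tᵢ≤tⱼ))

    hitsBelow-remove : ∀ t avoids → HitsBelow (toℕ c) t → HitsBelow (toℕ c) (removeColour t avoids)
    hitsBelow-remove t avoids hits d d<c
      with hits (punchIn c d) (subst (ℕ._< toℕ c) (sym (toℕ-punchIn-< c d d<c)) d<c)
    ... | i , tᵢ≡d = i , (begin
      lookup (removeColour t avoids) i    ≡⟨ lookup-remove t avoids i ⟩
      punchOut (avoids i)                 ≡⟨ Fin.punchOut-cong c tᵢ≡d ⟩
      punchOut (Fin.punchInᵢ≢i c d ∘ sym) ≡⟨ Fin.punchOut-punchIn c ⟩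
      d                                   ∎)

    hitsBelow-insert : ∀ t → HitsBelow (toℕ c) t → HitsBelow (toℕ c) (insertColour t)
    hitsBelow-insert t hits d d<c
      with hits (punchOut c≢d) (subst (ℕ._< toℕ c) (sym (toℕ-punchOut-< c≢d d<c)) d<c)
      where
      c≢d : c ≢ d
      c≢d = Fin.<⇒≢ d<c ∘ sym
    ... | i , tᵢ≡d = i , trans (lookup-insert t i) (trans (cong (punchIn c) tᵢ≡d) (Fin.punchIn-punchOut _))

    insertColour-avoids : ∀ t → ¬ Hit (insertColour t) c
    insertColour-avoids t (i , e) = Fin.punchInᵢ≢i c (lookup t i) (trans (sym (lookup-insert t i)) e)

    MissingColour : AdjMat n × Colouring n (suc k) → Set
    MissingColour (A , t) = TCondHitting (suc k) (toℕ c) (A , t) × ¬ Hit t c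

    missingColour-inverse : Inverse (dataSetoid MissingColour) (dataSetoid (TCondHitting k (toℕ c)))
    missingColour-inverse = mkInverse to from (λ {x} {y} → to-cong {x} {y}) (λ { refl → refl })
        (λ ((A , t) , _) → cong (A ,_) (remove-insert t (avoids (insertColour t) (insertColour-avoids t))))
        (λ ((A , t) , _ , ¬hit) → cong (A ,_) (insert-remove t (avoids t ¬hit)))
      where
      avoids : ∀ t → ¬ Hit t c → ∀ i → c ≢ lookup t i
      avoids t ¬hit i e = ¬hit (i , sym e)

      to : Σ _ MissingColour → Σ _ (TCondHitting k (toℕ c))
      to ((A , t) , ((tree , tiered) , hits) , ¬hit) =
        (A , removeColour t (avoids t ¬hit)) , (tree , isTiered-remove A t _ tiered) , hitsBelow-remove t _ hits

      from : Σ _ (TCondHitting k (toℕ c)) → Σ _ MissingColour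
      from ((A , t) , (tree , tiered) , hits) =
        (A , insertColour t) , ((tree , isTiered-insert A t tiered) , hitsBelow-insert t hits) , insertColour-avoids t

      to-cong : ∀ {x y} → proj₁ x ≡ proj₁ y → proj₁ (to x) ≡ proj₁ (to y)
      to-cong {(A , t) , _ , ¬hit} {(.A , .t) , _ , ¬hit′} refl =
        cong (A ,_) (removeColour-irrelevant t (avoids t ¬hit) (avoids t ¬hit′))

-- Counting by successive differences

-- T_{n,0} = T_{n,1} = 0, since a tiered colouring takes at least two values.
T̂ : (ℕ → ℕ) → ℕ → ℕ
T̂ T 0             = 0
T̂ T 1             = 0
T̂ T (suc (suc k)) = T (suc (suc k))

T̂-≥2 : ∀ T {k} → 2 ≤ k → T̂ T k ≡ T k
T̂-≥2 T (s≤s (s≤s _)) = refl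

∇-T̂-diagonal : ∀ T m → 2 ≤ m → ∇ m (+_ ∘ T̂ T) m ≡ rhs m T
∇-T̂-diagonal T (suc zero) (s≤s ())
∇-T̂-diagonal T (suc (suc m)) _ = begin
  ∇ M f M                        ≡⟨ ∇-binomial M f M ⟩
  (sumTo m t + t (suc m)) + t M  ≡⟨ cong₂ (λ x y → (sumTo m t + x) + y)
                                      (binomialTerm-vanishing f M M (suc m) (cong f (ℕ.m+n∸n≡m 1 m)))
                                      (binomialTerm-vanishing f M M M (cong f (ℕ.n∸n≡0 m))) ⟩
  (sumTo m t + + 0) + + 0        ≡⟨ trans (ℤ.+-identityʳ _) (ℤ.+-identityʳ _) ⟩
  sumTo m t                      ≡⟨ sumTo-cong m (λ i i≤m → cong (-1ℤ ^ i *_) (term≡ i i≤m)) ⟩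
  rhs M T                        ∎
  where
  M = suc (suc m)
  f = +_ ∘ T̂ T
  t = binomialTerm f M M
  term≡ : ∀ i → i ≤ m → + (M C i) * f (M ∸ i) ≡ + ((M C (M ∸ i)) ℕ.* T (M ∸ i))
  term≡ i i≤m = trans (sym (ℤ.pos-* (M C i) _)) (cong +_ (cong₂ ℕ._*_
    (nCk≡nC[n∸k] (ℕ.m≤n⇒m≤1+n (ℕ.m≤n⇒m≤1+n i≤m)))
    (T̂-≥2 T (subst (2 ≤_) (sym (ℕ.+-∸-assoc 2 i≤m)) (s≤s (s≤s z≤n))))))

CountsTo : {D : Set} → (D → Set) → ℤ → Set
CountsTo Q z = ∃ λ N → HasCard Q N × + N ≡ z

module _ (n : ℕ) (T : ℕ → ℕ) (hT : ∀ k → 2 ≤ k → HasCard (TCond n k) (T k)) where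

  HasCard-TCond : ∀ k → HasCard (TCond n k) (T̂ T k)
  HasCard-TCond 0 = HasCard-empty λ (A , t) (_ , tiered) → ℕ.<⇒≱ ℕ.z<s (isTiered⇒2≤k A t tiered)
  HasCard-TCond 1 = HasCard-empty λ (A , t) (_ , tiered) → ℕ.<-irrefl refl (isTiered⇒2≤k A t tiered)
  HasCard-TCond (suc (suc k)) = hT (suc (suc k)) (s≤s (s≤s z≤n))

  private
    f : ℕ → ℤ
    f = +_ ∘ T̂ T

  countsTo-hitting-zero : ∀ k → CountsTo (TCondHitting {n} k 0) (f k)
  countsTo-hitting-zero k =
    T̂ T k , HasCard-resp (λ _ x → x , λ _ ()) (λ _ → proj₁) (HasCard-TCond k) , refl

  countsTo-hitting-suc : ∀ {j k} (c : Fin (suc k)) → toℕ c ≡ j →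
    CountsTo (TCondHitting {n} (suc k) j) (∇ j f (suc k)) →
    CountsTo (TCondHitting {n} k j) (∇ j f k) →
    CountsTo (TCondHitting {n} (suc k) (suc j)) (∇ (suc j) f (suc k))
  countsTo-hitting-suc {k = k} c refl (N , H , N≡) (M , J , M≡)
    with HasCard-partition H (λ (_ , t) → Fin.any? (λ i → lookup t i Fin.≟ c))
  ... | a , b , Ha , Hb , a+b≡N = a , HasCard-resp add-hit split-hit Ha , (begin
    + a                ≡⟨ cancel (+ a) (+ b) ⟩
    (+ a + + b) - + b  ≡⟨ cong₂ _-_ (trans (sym (ℤ.pos-+ a b)) (cong +_ a+b≡N)) (cong +_ b≡M) ⟩
    + N - + M          ≡⟨ cong₂ _-_ N≡ M≡ ⟩
    ∇ (suc (toℕ c)) f (suc k) ∎)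
    where
    cancel : ∀ x y → x ≡ (x + y) - y
    cancel = solve-∀

    b≡M : b ≡ M
    b≡M = HasCard-unique (Composition.inverse Hb (missingColour-inverse c)) J

    add-hit : ∀ d → TCondHitting (suc k) (toℕ c) d × Hit (proj₂ d) c →
      TCondHitting (suc k) (suc (toℕ c)) d
    add-hit (_ , t) ((tcond , hits) , hit) = tcond , hitsBelow-suc {t = t} c hits hit

    split-hit : ∀ d → TCondHitting (suc k) (suc (toℕ c)) d →
      TCondHitting (suc k) (toℕ c) d × Hit (proj₂ d) c
    split-hit _ (tcond , hits) = (tcond , λ d d<c → hits d (ℕ.m≤n⇒m≤1+n d<c)) , hits c ℕ.≤-refl

  countsTo-hitting : ∀ j k → j ≤ k → CountsTo (TCondHitting {n} k j) (∇ j f k)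
  countsTo-hitting zero    k       _         = countsTo-hitting-zero k
  countsTo-hitting (suc j) (suc k) (s≤s j≤k) =
    countsTo-hitting-suc (fromℕ< (s≤s j≤k)) (Fin.toℕ-fromℕ< (s≤s j≤k))
      (countsTo-hitting j (suc k) (ℕ.m≤n⇒m≤1+n j≤k)) (countsTo-hitting j k j≤k)

proposition3p3 : (n m : ℕ) → 2 ≤ n → 2 ≤ m
    → (T : ℕ → ℕ) → (∀ k → 2 ≤ k → HasCard (TCond n k) (T k))
    → (P : ℕ) → HasCard (PCond n m) P
    → + P ≡ rhs m T
proposition3p3 n m _ 2≤m T hT P HP with countsTo-hitting n T hT m m ℕ.≤-refl
... | N , HN , N≡∇ = begin
  + P               ≡⟨ cong +_ (HasCard-unique HP′ HN) ⟩
  + N               ≡⟨ N≡∇ ⟩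
  ∇ m (+_ ∘ T̂ T) m  ≡⟨ ∇-T̂-diagonal T m 2≤m ⟩
  rhs m T           ∎
  where
  HP′ : HasCard (TCondHitting {n} m m) P
  HP′ = HasCard-resp (PCond⇒TCondHitting m) (TCondHitting⇒PCond m) HP
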